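{- Let $N$ be a positive integer with base-$\varphi$ representation $N=\sum_{k=R}^{L} d_k\varphi^k$, where $\varphi=\frac{1+\sqrt5}{2}$, $R\le 0\le L$ are integers, each $d_k\in\{0,1\}$, and $d_kd_{k+1}=0$ for all $k$. Suppose there is a positive index $j$ with $d_j=1$, and let $i$ be the smallest positive index with $d_i=1$. Then \[N = d_R(-1)^{ -R}L_{ -R}+\dots+d_{ -1}(-1)^{1}L_1+d_0 \quad\text{if } i \text{ is even},\] \[N = d_R(-1)^{ -R}L_{ -R}+\dots+d_{ -1}(-1)^{1}L_1+d_0-1 \quad\text{if } i \text{ is odd},\] i.e. $N=\sum_{k=R}^{ -1}d_k(-1)^{ -k}L_{ -k}+d_0-\epsilon$ with $\epsilon=0$ for $i$ even and $\epsilon=1$ for $i$ odd, where $L_n$ denotes the $n$-th Lucas number.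
   Context: The Lucas numbers are defined by $L_0=2$, $L_1=1$, $L_n=L_{n-1}+L_{n-2}$. A base-$\varphi$ representation of $N$ is an expression $N=\sum_{k=R}^{L}d_k\varphi^k$ with digits $d_k\in\{0,1\}$, no two consecutive digits equal to $1$, and $R\le 0\le L$; every positive integer has a unique such representation (up to leading/trailing zeros). -}

module Defs where

open import Data.Nat as ℕ using (ℕ; zero; suc)
open import Data.Integer as ℤ using (ℤ; +_; -[1+_]; _+_; _*_; _-_; -_)
open import Data.Product using (_×_; _,_)

lucas : ℕ → ℕ
lucas zero = 2
lucas (suc zero) = 1
lucas (suc (suc n)) = lucas (suc n) ℕ.+ lucas n

-- The ring ℤ[φ] (φ = (1+√5)/2, φ² = φ + 1): the pair (a , b) stands for a + b·φ.
-- Since 1, φ are linearly independent over ℚ, equality of pairs is exactly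
-- equality of the corresponding real numbers.
ℤφ : Set
ℤφ = ℤ × ℤ

zeroφ : ℤφ
zeroφ = (+ 0 , + 0)

oneφ : ℤφ
oneφ = (+ 1 , + 0)

_+φ_ : ℤφ → ℤφ → ℤφ
(a , b) +φ (c , d) = (a + c , b + d)

_·φ_ : ℤ → ℤφ → ℤφ
n ·φ (a , b) = (n * a , n * b)

-- multiplication by φ:  (a + bφ)φ = b + (a+b)φ
mulφ : ℤφ → ℤφ
mulφ (a , b) = (b , a + b)

-- multiplication by φ⁻¹ = φ - 1:  (a + bφ)(φ - 1) = (b - a) + aφ
divφ : ℤφ → ℤφ
divφ (a , b) = (b - a , a)

iter : (ℤφ → ℤφ) → ℕ → ℤφ → ℤφ
iter f zero x = x
iter f (suc n) x = f (iter f n x)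

φ^ : ℤ → ℤφ
φ^ (+ n) = iter mulφ n oneφ
φ^ -[1+ n ] = iter divφ (suc n) oneφ

embed : ℤ → ℤφ
embed n = (n , + 0)

sumFrom : ℤ → ℕ → (ℤ → ℤφ) → ℤφ
sumFrom a zero f = zeroφ
sumFrom a (suc n) f = f a +φ sumFrom (a + + 1) n f

phiValue : ℕ → ℕ → (ℤ → ℕ) → ℤφ
phiValue r l d = sumFrom (- (+ r)) (suc (r ℕ.+ l)) (λ k → (+ d k) ·φ φ^ k)

sgn : ℕ → ℤ
sgn zero = + 1
sgn (suc m) = - sgn m

lucasPart : ℕ → (ℤ → ℕ) → ℤ
lucasPart zero d = + 0
lucasPart (suc m) d = lucasPart m d + (+ d (- (+ suc m))) * (sgn (suc m) * + lucas (suc m))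

parityε : ℕ → ℤ
parityε zero = + 0
parityε (suc zero) = + 1
parityε (suc (suc n)) = parityε n

{-# OPTIONS --safe #-}
module Submission where

-- Conjugating N = Σ dₖ φ^k (φ ↦ ψ = 1 − φ = −φ⁻¹) and using ψ^(−m) = (−1)^m L_m − φ^(−m) yields
--   N = Σ_{m=1}^{r} d₋ₘ (−1)^m L_m + d₀ − Σ_{m=1}^{r} d₋ₘ φ^(−m) + Σ_{k=1}^{l} dₖ ψ^k.
-- Because the digits are 0/1 and never adjacent, Zeckendorf-type bounds put the first correction
-- in [0, 1) and the second in (0, 1) or (−1, 0) according to the sign (−1)^i of its leading term
-- ψ^i; since N is an integer, only the stated value remains. To argue in ℤ instead of ℝ,
-- everything is multiplied by F_M with M = r + l + 2: conjugation becomes the integer-valued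
-- functional Λ M below, and the two corrections become integers bounded by Zeckendorf's
-- inequality.

open import Defs

-- Integer arithmetic is opened only inside this block: the statement of theorem2 uses ℕ's _*_.
module _ where
  open import Data.Empty using (⊥-elim)
  open import Data.Integer as ℤ
    using (ℤ; +_; -[1+_]; _+_; _*_; _-_; -_; ∣_∣; +≤+; +<+; -≤+; -<+)
  import Data.Integer.Properties as ℤₚ
  open import Data.Integer.Tactic.RingSolver using (solve-∀)
  open import Data.Nat as ℕ
    using (ℕ; zero; suc; _≤_; _<_; _≤′_; ≤′-refl; ≤′-step; z≤n; s≤s)
  import Data.Nat.Properties as ℕₚ
  open import Data.Product using (_×_; _,_)
  open import Data.Sum as Sum using (_⊎_; inj₁; inj₂)
  open import Function using (_∘_; id; const)
  open import Relation.Binary.PropositionalEquality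

  fib : ℕ → ℕ
  fib 0             = 0
  fib 1             = 1
  fib (suc (suc n)) = fib (suc n) ℕ.+ fib n

  fib-≤-suc : ∀ n → fib n ≤ fib (suc n)
  fib-≤-suc 0             = z≤n
  fib-≤-suc 1             = ℕₚ.≤-refl
  fib-≤-suc (suc (suc n)) = ℕₚ.m≤m+n (fib (suc (suc n))) (fib (suc n))

  fib-mono : ∀ {m n} → m ≤ n → fib m ≤ fib n
  fib-mono = mono′ ∘ ℕₚ.≤⇒≤′
    where
    mono′ : ∀ {m n} → m ≤′ n → fib m ≤ fib n
    mono′ ≤′-refl            = ℕₚ.≤-refl
    mono′ (≤′-step {n} m≤′n) = ℕₚ.≤-trans (mono′ m≤′n) (fib-≤-suc n)

  fib-pos : ∀ {n} → 0 < n → 0 < fib n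
  fib-pos {suc n} _ = fib-mono {1} {suc n} (s≤s z≤n)

  ∑ : ℕ → (ℕ → ℤ) → ℤ
  ∑ zero    f = + 0
  ∑ (suc n) f = f 0 + ∑ n (f ∘ suc)

  ∑-cong : ∀ n {f g} → (∀ {k} → k < n → f k ≡ g k) → ∑ n f ≡ ∑ n g
  ∑-cong zero    _   = refl
  ∑-cong (suc n) f≗g = cong₂ _+_ (f≗g (s≤s z≤n)) (∑-cong n (f≗g ∘ s≤s))

  ∑-nonneg : ∀ n {f} → (∀ {k} → k < n → + 0 ℤ.≤ f k) → + 0 ℤ.≤ ∑ n f
  ∑-nonneg zero    _   = ℤₚ.≤-refl
  ∑-nonneg (suc n) f≥0 = ℤₚ.+-mono-≤ (f≥0 (s≤s z≤n)) (∑-nonneg n (f≥0 ∘ s≤s))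

  ∑-snoc : ∀ n f → ∑ (suc n) f ≡ ∑ n f + f n
  ∑-snoc zero    f = ℤₚ.+-comm (f 0) (+ 0)
  ∑-snoc (suc n) f =
    trans (cong (_+_ (f 0)) (∑-snoc n (f ∘ suc))) (sym (ℤₚ.+-assoc (f 0) _ _))

  ∑-+ : ∀ m n f → ∑ (m ℕ.+ n) f ≡ ∑ m f + ∑ n (λ k → f (m ℕ.+ k))
  ∑-+ zero    n f = sym (ℤₚ.+-identityˡ _)
  ∑-+ (suc m) n f =
    trans (cong (_+_ (f 0)) (∑-+ m n (f ∘ suc))) (sym (ℤₚ.+-assoc (f 0) _ _))

  ∑-affine : ∀ n f g c → ∑ n (λ k → f k * c - g k) ≡ ∑ n f * c - ∑ n g
  ∑-affine zero    f g c = sym (ℤₚ.*-zeroˡ c)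
  ∑-affine (suc n) f g c =
    trans (cong (_+_ (f 0 * c - g 0)) (∑-affine n (f ∘ suc) (g ∘ suc) c))
          (regroup (f 0) (∑ n (f ∘ suc)) (g 0) (∑ n (g ∘ suc)) c)
    where
    regroup : ∀ a b x y c → (a * c - x) + (b * c - y) ≡ (a + b) * c - (x + y)
    regroup = solve-∀

  ∑-reflect : ∀ r (g : ℤ → ℤ) → ∑ r (λ k → g (- (+ r) + + k)) ≡ ∑ r (λ k → g -[1+ k ])
  ∑-reflect zero    g = refl
  ∑-reflect (suc r) g = begin
      g (-[1+ r ] + + 0) + ∑ r (λ k → g (-[1+ r ] + + suc k))
    ≡⟨ cong₂ _+_ (cong g (ℤₚ.+-identityʳ _))
                 (∑-cong r λ {k} _ → cong g (shift (+ r) (+ k))) ⟩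
      g -[1+ r ] + ∑ r (λ k → g (- (+ r) + + k))
    ≡⟨ cong (_+_ (g -[1+ r ])) (∑-reflect r g) ⟩
      g -[1+ r ] + ∑ r (λ k → g -[1+ k ])
    ≡⟨ ℤₚ.+-comm (g -[1+ r ]) _ ⟩
      ∑ r (λ k → g -[1+ k ]) + g -[1+ r ]
    ≡⟨ sym (∑-snoc r _) ⟩
      ∑ (suc r) (λ k → g -[1+ k ])
    ∎
    where
    open ≡-Reasoning
    shift : ∀ a b → - (+ 1 + a) + (+ 1 + b) ≡ - a + b
    shift = solve-∀

  -- Zeckendorf bounds for signed Fibonacci digits

  record FibonacciDigits (M n : ℕ) (h : ℕ → ℤ) : Set where
    field
      bounded : ∀ {k} → k < n → ∣ h k ∣ ≤ fib (M ℕ.∸ k)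
      sparse  : ∀ {k} → suc k < n → h k ≡ + 0 ⊎ h (suc k) ≡ + 0
  open FibonacciDigits

  digits-tail : ∀ {M n h} → FibonacciDigits (suc M) (suc n) h → FibonacciDigits M n (h ∘ suc)
  digits-tail digits = record
    { bounded = bounded digits ∘ s≤s
    ; sparse  = sparse digits ∘ s≤s
    }

  fromDigits : ∀ {M n h} (e : ℕ → ℕ)
    → (∀ {k} → k < n → e k ≤ 1)
    → (∀ {k} → suc k < n → e k ℕ.* e (suc k) ≡ 0)
    → (∀ {k} → k < n → ∣ h k ∣ ≡ e k ℕ.* fib (M ℕ.∸ k))
    → FibonacciDigits M n h
  fromDigits {M} {n} {h} e binary nonAdjacent ∣h∣≡ = record
    { bounded = weight-bound
    ; sparse  = λ {k} 1+k<n → Sum.map (vanish (ℕₚ.<⇒≤ 1+k<n)) (vanish 1+k<n)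
        (ℕₚ.m*n≡0⇒m≡0∨n≡0 (e k) (nonAdjacent 1+k<n))
    }
    where
    open ℕₚ.≤-Reasoning
    weight-bound : ∀ {k} → k < n → ∣ h k ∣ ≤ fib (M ℕ.∸ k)
    weight-bound {k} k<n = begin
      ∣ h k ∣                 ≡⟨ ∣h∣≡ k<n ⟩
      e k ℕ.* fib (M ℕ.∸ k)   ≤⟨ ℕₚ.*-monoˡ-≤ (fib (M ℕ.∸ k)) (binary k<n) ⟩
      1 ℕ.* fib (M ℕ.∸ k)     ≡⟨ ℕₚ.*-identityˡ (fib (M ℕ.∸ k)) ⟩
      fib (M ℕ.∸ k)           ∎
    vanish : ∀ {k} → k < n → e k ≡ 0 → h k ≡ + 0
    vanish k<n eₖ≡0 = ℤₚ.∣i∣≡0⇒i≡0 (trans (∣h∣≡ k<n) (cong (ℕ._* _) eₖ≡0))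

  first-or-second-vanishes : ∀ {M n h} → FibonacciDigits M (suc n) h
    → h 0 ≡ + 0 ⊎ (0 < n → h 1 ≡ + 0)
  first-or-second-vanishes {n = zero}  _      = inj₂ λ ()
  first-or-second-vanishes {n = suc n} digits =
    Sum.map₂ const (sparse digits (s≤s (s≤s z≤n)))

  -- n < M keeps every weight at F₂ or above; with both F₁ = F₂ available the bound would fail.
  mutual
    zeckendorf : ∀ {M n h} → n < M → FibonacciDigits M n h → ∣ ∑ n h ∣ < fib (suc M)
    zeckendorf {M} {zero} _ _ = fib-pos {suc M} (s≤s z≤n)
    zeckendorf {suc (suc M)} {suc n} {h} 1+n<M@(s≤s n<1+M@(s≤s _)) digits =
      Sum.[ (λ h₀≡0 → ℕₚ.<-≤-trans (zeckendorf₀ 1+n<M digits (λ _ → h₀≡0))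
                                   (fib-≤-suc (suc (suc M))))
          , (λ h₁≡0 → begin-strict
              ∣ h 0 + ∑ n (h ∘ suc) ∣        ≤⟨ ℤₚ.∣i+j∣≤∣i∣+∣j∣ (h 0) _ ⟩
              ∣ h 0 ∣ ℕ.+ ∣ ∑ n (h ∘ suc) ∣  <⟨ ℕₚ.+-mono-≤-< (bounded digits (s≤s z≤n))
                                               (zeckendorf₀ n<1+M (digits-tail digits) h₁≡0) ⟩
              fib (suc (suc (suc M)))      ∎)
          ] (first-or-second-vanishes digits)
      where open ℕₚ.≤-Reasoning

    zeckendorf₀ : ∀ {M n h} → n < M → FibonacciDigits M n h → (0 < n → h 0 ≡ + 0)
      → ∣ ∑ n h ∣ < fib M
    zeckendorf₀ {n = zero} 0<M _ _ = fib-pos 0<M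
    zeckendorf₀ {suc M} {suc n} {h} (s≤s n<M) digits h₀≡0 = begin-strict
        ∣ h 0 + ∑ n (h ∘ suc) ∣  ≡⟨ cong (λ x → ∣ x + ∑ n (h ∘ suc) ∣) (h₀≡0 (s≤s z≤n)) ⟩
        ∣ + 0 + ∑ n (h ∘ suc) ∣  ≡⟨ cong ∣_∣ (ℤₚ.+-identityˡ (∑ n (h ∘ suc))) ⟩
        ∣ ∑ n (h ∘ suc) ∣        <⟨ zeckendorf n<M (digits-tail digits) ⟩
        fib (suc M)              ∎
      where open ℕₚ.≤-Reasoning

  leading-digit : ∀ {M n h} j → j < n → n ≤ M → FibonacciDigits (suc M) n h
    → (∀ {k} → k < j → h k ≡ + 0) → h j ≢ + 0 → ∣ ∑ n h - h j ∣ < fib (M ℕ.∸ j)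
  leading-digit {M} {suc n} {h} zero _ n<M digits _ h₀≢0 = begin-strict
      ∣ h 0 + ∑ n (h ∘ suc) - h 0 ∣  ≡⟨ cong ∣_∣ (cancel (h 0) _) ⟩
      ∣ ∑ n (h ∘ suc) ∣              <⟨ zeckendorf₀ n<M (digits-tail digits) second-vanishes ⟩
      fib M                          ∎
    where
    open ℕₚ.≤-Reasoning
    cancel : ∀ a b → a + b - a ≡ b
    cancel = solve-∀
    second-vanishes : 0 < n → h 1 ≡ + 0
    second-vanishes 0<n = Sum.[ ⊥-elim ∘ h₀≢0 , id ] (sparse digits (s≤s 0<n))
  leading-digit {suc M} {suc n} {h} (suc j) (s≤s j<n) (s≤s n≤M) digits zeros hⱼ≢0 = begin-strict
      ∣ h 0 + ∑ n (h ∘ suc) - h (suc j) ∣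
    ≡⟨ cong (λ x → ∣ x + ∑ n (h ∘ suc) - h (suc j) ∣) (zeros (s≤s z≤n)) ⟩
      ∣ + 0 + ∑ n (h ∘ suc) - h (suc j) ∣
    ≡⟨ cong (λ x → ∣ x - h (suc j) ∣) (ℤₚ.+-identityˡ (∑ n (h ∘ suc))) ⟩
      ∣ ∑ n (h ∘ suc) - h (suc j) ∣
    <⟨ leading-digit j j<n n≤M (digits-tail digits) (λ k<j → zeros (s≤s k<j)) hⱼ≢0 ⟩
      fib (M ℕ.∸ j)
    ∎
    where open ℕₚ.≤-Reasoning

  sgn-parity : ∀ i → (sgn i ≡ + 1 × parityε i ≡ + 0) ⊎ (sgn i ≡ - + 1 × parityε i ≡ + 1)
  sgn-parity 0             = inj₁ (refl , refl)
  sgn-parity 1             = inj₂ (refl , refl)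
  sgn-parity (suc (suc i)) rewrite ℤₚ.neg-involutive (sgn i) = sgn-parity i

  sgn-squared : ∀ m → sgn m * sgn m ≡ + 1
  sgn-squared m with sgn-parity m
  ... | inj₁ (σ≡1 , _)  rewrite σ≡1  = refl
  ... | inj₂ (σ≡-1 , _) rewrite σ≡-1 = refl

  ∣sgn*∣ : ∀ m n → ∣ sgn m * + n ∣ ≡ n
  ∣sgn*∣ m n with sgn-parity m
  ... | inj₁ (σ≡1 , _)  rewrite σ≡1  = cong ∣_∣ (ℤₚ.*-identityˡ (+ n))
  ... | inj₂ (σ≡-1 , _) rewrite σ≡-1 = trans (cong ∣_∣ (ℤₚ.-1*i≡-i (+ n))) (ℤₚ.∣-i∣≡∣i∣ (+ n))

  infix 4 0≤_<_
  0≤_<_ : ℤ → ℕ → Set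
  0≤ x < F = + 0 ℤ.≤ x × x ℤ.< + F

  ∣i∣≥i : ∀ i → i ℤ.≤ + ∣ i ∣
  ∣i∣≥i (+ n)    = ℤₚ.≤-refl
  ∣i∣≥i -[1+ n ] = -≤+

  -∣i∣≤i : ∀ i → - (+ ∣ i ∣) ℤ.≤ i
  -∣i∣≤i (+ n)    = ℤₚ.neg-≤-pos
  -∣i∣≤i -[1+ n ] = ℤₚ.≤-refl

  centred-window : ∀ {c B F} t → ∣ t ∣ < B → + B ℤ.≤ c → c + + B ℤ.≤ + F → 0≤ c + t < F
  centred-window {c} {B} {F} t ∣t∣<B B≤c c+B≤F = lower , upper
    where
    open ℤₚ.≤-Reasoning
    -B≤t : - (+ B) ℤ.≤ t
    -B≤t = ℤₚ.≤-trans (ℤₚ.neg-mono-≤ (+≤+ (ℕₚ.<⇒≤ ∣t∣<B))) (-∣i∣≤i t)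
    lower : + 0 ℤ.≤ c + t
    lower = begin
      + 0        ≤⟨ ℤₚ.i≤j⇒0≤j-i B≤c ⟩
      c - + B    ≤⟨ ℤₚ.+-monoʳ-≤ c -B≤t ⟩
      c + t      ∎
    upper : c + t ℤ.< + F
    upper = begin-strict
      c + t      <⟨ ℤₚ.+-monoʳ-< c (ℤₚ.≤-<-trans (∣i∣≥i t) (+<+ ∣t∣<B)) ⟩
      c + + B    ≤⟨ c+B≤F ⟩
      + F        ∎

  window : ∀ i {A B F} t → B ≤ A → A ℕ.+ B ≤ F → ∣ t ∣ < B
    → 0≤ sgn i * + A + parityε i * + F + t < F
  window i {A} {B} {F} t B≤A A+B≤F ∣t∣<B with sgn-parity i
  ... | inj₁ (σ≡1 , ε≡0) = centred-window t ∣t∣<B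
      (subst (+ B ℤ.≤_) (sym c≡A) (+≤+ B≤A))
      (subst (λ c → c + + B ℤ.≤ + F) (sym c≡A) (+≤+ A+B≤F))
    where
    even : ∀ a f → + 1 * a + + 0 * f ≡ a
    even = solve-∀
    c≡A : sgn i * + A + parityε i * + F ≡ + A
    c≡A rewrite σ≡1 | ε≡0 = even (+ A) (+ F)
  ... | inj₂ (σ≡-1 , ε≡1) = centred-window t ∣t∣<B lower upper
    where
    open ℤₚ.≤-Reasoning
    odd : ∀ a f → - + 1 * a + + 1 * f ≡ f - a
    odd = solve-∀
    c≡F-A : sgn i * + A + parityε i * + F ≡ + F - + A
    c≡F-A rewrite σ≡-1 | ε≡1 = odd (+ A) (+ F)
    shuffle : ∀ a b → b ≡ a + b - a
    shuffle = solve-∀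
    restore : ∀ a f → f - a + a ≡ f
    restore = solve-∀
    lower : + B ℤ.≤ sgn i * + A + parityε i * + F
    lower = begin
      + B              ≡⟨ shuffle (+ A) (+ B) ⟩
      + A + + B - + A  ≤⟨ ℤₚ.+-monoˡ-≤ (- + A) (+≤+ A+B≤F) ⟩
      + F - + A        ≡⟨ sym c≡F-A ⟩
      sgn i * + A + parityε i * + F ∎
    upper : sgn i * + A + parityε i * + F + + B ℤ.≤ + F
    upper = begin
      sgn i * + A + parityε i * + F + + B ≡⟨ cong (_+ + B) c≡F-A ⟩
      + F - + A + + B                     ≤⟨ ℤₚ.+-monoʳ-≤ (+ F - + A) (+≤+ B≤A) ⟩
      + F - + A + + A                     ≡⟨ restore (+ A) (+ F) ⟩
      + F                                 ∎

  ∣i*n∣<n⇒i≡0 : ∀ i n → ∣ i * + n ∣ < n → i ≡ + 0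
  ∣i*n∣<n⇒i≡0 i n ∣in∣<n =
    ℤₚ.∣i∣≡0⇒i≡0 (m*n<n⇒m≡0 ∣ i ∣ (subst (_< n) (ℤₚ.abs-* i (+ n)) ∣in∣<n))
    where
    m*n<n⇒m≡0 : ∀ m → m ℕ.* n < n → m ≡ 0
    m*n<n⇒m≡0 zero    _     = refl
    m*n<n⇒m≡0 (suc m) mn<n = ⊥-elim (ℕₚ.<⇒≱ mn<n (ℕₚ.m≤m+n n (m ℕ.* n)))

  ∣x-y∣<n : ∀ {x y n} → 0≤ x < n → 0≤ y < n → ∣ x - y ∣ < n
  ∣x-y∣<n {+ a} {+ b} {n} (_ , +<+ a<n) (_ , +<+ b<n) = begin-strict
      ∣ + a - + b ∣  ≡⟨ cong ∣_∣ (ℤₚ.m-n≡m⊖n a b) ⟩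
      ∣ a ℤ.⊖ b ∣    ≤⟨ ℤₚ.∣m⊝n∣≤m⊔n a b ⟩
      a ℕ.⊔ b        <⟨ ℕₚ.⊔-lub a<n b<n ⟩
      n              ∎
    where open ℕₚ.≤-Reasoning

  cancel-scaled : ∀ {u Q W : ℤ} {F : ℕ} L d₀ ε
    → u * + F ≡ L * + F - Q + d₀ * + F + W
    → 0≤ Q < F → 0≤ W + ε * + F < F → u ≡ L + d₀ - ε
  cancel-scaled {u} {Q} {W} {F} L d₀ ε expansion Q-range W-range =
    ℤₚ.i-j≡0⇒i≡j u (L + d₀ - ε)
      (∣i*n∣<n⇒i≡0 (u - (L + d₀ - ε)) F
        (subst (λ y → ∣ y ∣ < F) (sym gap) (∣x-y∣<n W-range Q-range)))
    where
    open ≡-Reasoning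
    distrib : ∀ u v f → (u - v) * f ≡ u * f - v * f
    distrib = solve-∀
    collect : ∀ L Q d W e f → L * f - Q + d * f + W - (L + d - e) * f ≡ W + e * f - Q
    collect = solve-∀
    gap : (u - (L + d₀ - ε)) * + F ≡ W + ε * + F - Q
    gap = begin
      (u - (L + d₀ - ε)) * + F                         ≡⟨ distrib u (L + d₀ - ε) (+ F) ⟩
      u * + F - (L + d₀ - ε) * + F                     ≡⟨ cong (_- (L + d₀ - ε) * + F) expansion ⟩
      L * + F - Q + d₀ * + F + W - (L + d₀ - ε) * + F  ≡⟨ collect L Q d₀ W ε (+ F) ⟩
      W + ε * + F - Q                                  ∎

  -- For x = a + bφ with conjugate x̄ = a + bψ, Λ M x = (φ^M x̄ − ψ^M x)/√5 = F_M x̄ − b ψ^M: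
  -- conjugation scaled by F_M, up to an error that vanishes as M grows.
  Λ : ℕ → ℤφ → ℤ
  Λ zero    (a , b) = - b
  Λ (suc M) (a , b) = a * + fib (suc M) - b * + fib M

  Λ-+ : ∀ M x y → Λ M (x +φ y) ≡ Λ M x + Λ M y
  Λ-+ zero    (a , b) (c , d) = ℤₚ.neg-distrib-+ b d
  Λ-+ (suc M) (a , b) (c , d) = additive a b c d (+ fib (suc M)) (+ fib M)
    where
    additive : ∀ a b c d F G → (a + c) * F - (b + d) * G ≡ (a * F - b * G) + (c * F - d * G)
    additive = solve-∀

  Λ-· : ∀ M n x → Λ M (n ·φ x) ≡ n * Λ M x
  Λ-· zero    n (a , b) = ℤₚ.neg-distribʳ-* n b
  Λ-· (suc M) n (a , b) = homogeneous n a b (+ fib (suc M)) (+ fib M)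
    where
    homogeneous : ∀ n a b F G → n * a * F - n * b * G ≡ n * (a * F - b * G)
    homogeneous = solve-∀

  Λ-embed : ∀ M n → Λ M (embed n) ≡ n * + fib M
  Λ-embed zero    n = sym (ℤₚ.*-zeroʳ n)
  Λ-embed (suc M) n = ℤₚ.+-identityʳ (n * + fib (suc M))

  Λ-mulφ : ∀ M x → Λ (suc M) (mulφ x) ≡ - Λ M x
  Λ-mulφ zero    (a , b) = shift a b
    where
    shift : ∀ a b → b * + 1 - (a + b) * + 0 ≡ - - b
    shift = solve-∀
  Λ-mulφ (suc M) (a , b) = shift a b (+ fib (suc M)) (+ fib M)
    where
    shift : ∀ a b F G → b * (F + G) - (a + b) * F ≡ - (a * F - b * G)
    shift = solve-∀

  Λ-φ^ : ∀ {M} k → k ≤ M → Λ M (iter mulφ k oneφ) ≡ sgn k * + fib (M ℕ.∸ k)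
  Λ-φ^ {M}     zero    _         = Λ-embed M (+ 1)
  Λ-φ^ {suc M} (suc k) (s≤s k≤M) = begin
      Λ (suc M) (mulφ (iter mulφ k oneφ))  ≡⟨ Λ-mulφ M _ ⟩
      - Λ M (iter mulφ k oneφ)             ≡⟨ cong -_ (Λ-φ^ k k≤M) ⟩
      - (sgn k * + fib (M ℕ.∸ k))          ≡⟨ ℤₚ.neg-distribˡ-* (sgn k) _ ⟩
      - sgn k * + fib (M ℕ.∸ k)            ∎
    where open ≡-Reasoning

  -- multiplication by ψ = 1 − φ:  (a + bφ)(1 − φ) = (a − b) − aφ
  mulψ : ℤφ → ℤφ
  mulψ (a , b) = (a - b , - a)

  lucas-binet : ∀ m → iter mulφ m oneφ +φ iter mulψ m oneφ ≡ embed (+ lucas m)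
  lucas-binet 0             = refl
  lucas-binet 1             = refl
  lucas-binet (suc (suc m)) =
    trans (recurrence (iter mulφ m oneφ) (iter mulψ m oneφ))
          (cong₂ _+φ_ (lucas-binet (suc m)) (lucas-binet m))
    where
    recurrence : ∀ x y → mulφ (mulφ x) +φ mulψ (mulψ y) ≡ (mulφ x +φ mulψ y) +φ (x +φ y)
    recurrence (a , b) (c , d) = cong₂ _,_ (first a b c d) (second a b c d)
      where
      first : ∀ a b c d → (a + b) + ((c - d) - - c) ≡ (b + (c - d)) + (a + c)
      first = solve-∀
      second : ∀ a b c d → (b + (a + b)) + - (c - d) ≡ ((a + b) + - c) + (b + d)
      second = solve-∀

  φ⁻-as-ψ : ∀ m → iter divφ m oneφ ≡ sgn m ·φ iter mulψ m oneφ
  φ⁻-as-ψ zero    = refl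
  φ⁻-as-ψ (suc m) = trans (cong divφ (φ⁻-as-ψ m)) (divφ-· (sgn m) (iter mulψ m oneφ))
    where
    divφ-· : ∀ s x → divφ (s ·φ x) ≡ (- s) ·φ mulψ x
    divφ-· s (a , b) = cong₂ _,_ (first s a b) (second s a)
      where
      first : ∀ s a b → s * b - s * a ≡ - s * (a - b)
      first = solve-∀
      second : ∀ s a → s * a ≡ - s * - a
      second = solve-∀

  Λ-φ⁻ : ∀ {M} m → m ≤ M
    → Λ M (iter divφ m oneφ) ≡ sgn m * + lucas m * + fib M - + fib (M ℕ.∸ m)
  Λ-φ⁻ {M} m m≤M = begin
      Λ M (iter divφ m oneφ)
    ≡⟨ cong (Λ M) (φ⁻-as-ψ m) ⟩
      Λ M (sgn m ·φ ψᵐ)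
    ≡⟨ Λ-· M (sgn m) ψᵐ ⟩
      sgn m * Λ M ψᵐ
    ≡⟨ cong (sgn m *_) Λψᵐ ⟩
      sgn m * (+ lucas m * + fib M - sgn m * + fib (M ℕ.∸ m))
    ≡⟨ distrib (sgn m) (+ lucas m * + fib M) (+ fib (M ℕ.∸ m)) ⟩
      sgn m * (+ lucas m * + fib M) - sgn m * sgn m * + fib (M ℕ.∸ m)
    ≡⟨ cong₂ _-_ (sym (ℤₚ.*-assoc (sgn m) _ _))
                 (trans (cong (_* + fib (M ℕ.∸ m)) (sgn-squared m)) (ℤₚ.*-identityˡ _)) ⟩
      sgn m * + lucas m * + fib M - + fib (M ℕ.∸ m)
    ∎
    where
    open ≡-Reasoning
    φᵐ ψᵐ : ℤφ
    φᵐ = iter mulφ m oneφ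
    ψᵐ = iter mulψ m oneφ
    distrib : ∀ s x y → s * (x - s * y) ≡ s * x - s * s * y
    distrib = solve-∀
    difference : ∀ a b → b ≡ (a + b) - a
    difference = solve-∀
    Λψᵐ : Λ M ψᵐ ≡ + lucas m * + fib M - sgn m * + fib (M ℕ.∸ m)
    Λψᵐ = begin
        Λ M ψᵐ
      ≡⟨ difference (Λ M φᵐ) (Λ M ψᵐ) ⟩
        Λ M φᵐ + Λ M ψᵐ - Λ M φᵐ
      ≡⟨ cong₂ _-_ (sym (Λ-+ M φᵐ ψᵐ)) (Λ-φ^ m m≤M) ⟩
        Λ M (φᵐ +φ ψᵐ) - sgn m * + fib (M ℕ.∸ m)
      ≡⟨ cong (λ x → Λ M x - sgn m * + fib (M ℕ.∸ m)) (lucas-binet m) ⟩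
        Λ M (embed (+ lucas m)) - sgn m * + fib (M ℕ.∸ m)
      ≡⟨ cong (_- sgn m * + fib (M ℕ.∸ m)) (Λ-embed M (+ lucas m)) ⟩
        + lucas m * + fib M - sgn m * + fib (M ℕ.∸ m)
      ∎

  Λ-sumFrom : ∀ M a n f → Λ M (sumFrom a n f) ≡ ∑ n (λ k → Λ M (f (a + + k)))
  Λ-sumFrom M a zero    f = Λ-embed M (+ 0)
  Λ-sumFrom M a (suc n) f = begin
      Λ M (f a +φ sumFrom (a + + 1) n f)
    ≡⟨ Λ-+ M (f a) (sumFrom (a + + 1) n f) ⟩
      Λ M (f a) + Λ M (sumFrom (a + + 1) n f)
    ≡⟨ cong₂ _+_ (cong (Λ M ∘ f) (sym (ℤₚ.+-identityʳ a))) (Λ-sumFrom M (a + + 1) n f) ⟩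
      Λ M (f (a + + 0)) + ∑ n (λ k → Λ M (f (a + + 1 + + k)))
    ≡⟨ cong (_+_ (Λ M (f (a + + 0))))
            (∑-cong n λ {k} _ → cong (Λ M ∘ f) (ℤₚ.+-assoc a (+ 1) (+ k))) ⟩
      ∑ (suc n) (λ k → Λ M (f (a + + k)))
    ∎
    where open ≡-Reasoning

  -- Applying Λ to a base-φ expansion

  lucasDigit : (ℤ → ℕ) → ℕ → ℤ
  lucasDigit d k = + d -[1+ k ] * (sgn (suc k) * + lucas (suc k))

  lucasPart-∑ : ∀ r d → lucasPart r d ≡ ∑ r (lucasDigit d)
  lucasPart-∑ zero    d = refl
  lucasPart-∑ (suc r) d =
    trans (cong (_+ lucasDigit d r) (lucasPart-∑ r d)) (sym (∑-snoc r (lucasDigit d)))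

  -- Integer stand-ins for F_M Σ_{m=1}^{r} d₋ₘ φ^(−m) and F_M Σ_{k=1}^{l} dₖ ψ^k.
  fractionalDigit conjugateDigit : ℕ → (ℤ → ℕ) → ℕ → ℤ
  fractionalDigit M d k = + d -[1+ k ] * + fib (M ℕ.∸ suc k)
  conjugateDigit  M d k = + d (+ suc k) * (sgn (suc k) * + fib (M ℕ.∸ suc k))

  fractionalPart conjugatePart : ℕ → ℕ → (ℤ → ℕ) → ℤ
  fractionalPart M r d = ∑ r (fractionalDigit M d)
  conjugatePart  M l d = ∑ l (conjugateDigit M d)

  Λ-phiValue : ∀ {M} r l d → r ≤ M → l ≤ M
    → Λ M (phiValue r l d)
      ≡ lucasPart r d * + fib M - fractionalPart M r d + + d (+ 0) * + fib M + conjugatePart M l d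
  Λ-phiValue {M} r l d r≤M l≤M = begin
      Λ M (phiValue r l d)
    ≡⟨ Λ-sumFrom M (- (+ r)) (suc (r ℕ.+ l)) (λ k → (+ d k) ·φ φ^ k) ⟩
      ∑ (suc (r ℕ.+ l)) (λ k → term (- (+ r) + + k))
    ≡⟨ cong (λ n → ∑ n (λ k → term (- (+ r) + + k))) (sym (ℕₚ.+-suc r l)) ⟩
      ∑ (r ℕ.+ suc l) (λ k → term (- (+ r) + + k))
    ≡⟨ ∑-+ r (suc l) _ ⟩
      ∑ r (λ k → term (- (+ r) + + k)) + ∑ (suc l) (λ k → term (- (+ r) + + (r ℕ.+ k)))
    ≡⟨ cong₂ _+_ (∑-reflect r term) (∑-cong (suc l) λ {k} _ → cong term (cancel (+ r) (+ k))) ⟩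
      ∑ r (λ k → term -[1+ k ]) + (term (+ 0) + ∑ l (λ k → term (+ suc k)))
    ≡⟨ cong₂ _+_ negative (cong₂ _+_ zeroth positive) ⟩
      lucasPart r d * + fib M - fractionalPart M r d + (+ d (+ 0) * + fib M + conjugatePart M l d)
    ≡⟨ sym (ℤₚ.+-assoc (lucasPart r d * + fib M - fractionalPart M r d) _ _) ⟩
      lucasPart r d * + fib M - fractionalPart M r d + + d (+ 0) * + fib M + conjugatePart M l d
    ∎
    where
    open ≡-Reasoning
    term : ℤ → ℤ
    term k = Λ M ((+ d k) ·φ φ^ k)
    cancel : ∀ a b → - a + (a + b) ≡ b
    cancel = solve-∀
    expand : ∀ x s L F G → x * (s * L * F - G) ≡ x * (s * L) * F - x * G
    expand = solve-∀
    negative : ∑ r (λ k → term -[1+ k ]) ≡ lucasPart r d * + fib M - fractionalPart M r d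
    negative = begin
        ∑ r (λ k → term -[1+ k ])
      ≡⟨ ∑-cong r (λ {k} k<r → trans (Λ-· M (+ d -[1+ k ]) (φ^ -[1+ k ]))
           (trans (cong (+ d -[1+ k ] *_) (Λ-φ⁻ (suc k) (ℕₚ.≤-trans k<r r≤M)))
                  (expand (+ d -[1+ k ]) (sgn (suc k)) (+ lucas (suc k)) (+ fib M)
                          (+ fib (M ℕ.∸ suc k))))) ⟩
        ∑ r (λ k → lucasDigit d k * + fib M - fractionalDigit M d k)
      ≡⟨ ∑-affine r (lucasDigit d) (fractionalDigit M d) (+ fib M) ⟩
        ∑ r (lucasDigit d) * + fib M - fractionalPart M r d
      ≡⟨ cong (λ x → x * + fib M - fractionalPart M r d) (sym (lucasPart-∑ r d)) ⟩
        lucasPart r d * + fib M - fractionalPart M r d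
      ∎
    zeroth : term (+ 0) ≡ + d (+ 0) * + fib M
    zeroth = trans (Λ-· M (+ d (+ 0)) oneφ)
                   (cong (+ d (+ 0) *_) (trans (Λ-φ^ {M} 0 z≤n) (ℤₚ.*-identityˡ (+ fib M))))
    positive : ∑ l (λ k → term (+ suc k)) ≡ conjugatePart M l d
    positive = ∑-cong l λ {k} k<l →
      trans (Λ-· M (+ d (+ suc k)) (φ^ (+ suc k)))
            (cong (+ d (+ suc k) *_) (Λ-φ^ (suc k) (ℕₚ.≤-trans k<l l≤M)))

  -- With this choice every digit position of a word on [−r, l] carries a weight F_j, j ≥ 2.
  scale : ℕ → ℕ → ℕ
  scale r l = 2 ℕ.+ r ℕ.+ l

  Λ-expansion : ∀ N r l d → embed (+ N) ≡ phiValue r l d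
    → + N * + fib (scale r l)
      ≡ lucasPart r d * + fib (scale r l) - fractionalPart (scale r l) r d
        + + d (+ 0) * + fib (scale r l) + conjugatePart (scale r l) l d
  Λ-expansion N r l d value = begin
      + N * + fib M          ≡⟨ sym (Λ-embed M (+ N)) ⟩
      Λ M (embed (+ N))      ≡⟨ cong (Λ M) value ⟩
      Λ M (phiValue r l d)   ≡⟨ Λ-phiValue r l d (ℕₚ.≤-trans (ℕₚ.m≤m+n r l) (ℕₚ.m≤n+m _ 2))
                                                   (ℕₚ.m≤n+m l (2 ℕ.+ r)) ⟩
      lucasPart r d * + fib M - fractionalPart M r d + + d (+ 0) * + fib M + conjugatePart M l d ∎
    where
    open ≡-Reasoning
    M : ℕ
    M = scale r l

  -- Bounds on the two corrections

  Binary NonAdjacent : ℕ → ℕ → (ℤ → ℕ) → Set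
  Binary      r l d = ∀ k → - (+ r) ℤ.≤ k → k ℤ.≤ + l → d k ≤ 1
  NonAdjacent r l d = ∀ k → - (+ r) ℤ.≤ k → k ℤ.< + l → d k ℕ.* d (k + + 1) ≡ 0

  fractional-digits : ∀ r l d → Binary r l d → NonAdjacent r l d
    → FibonacciDigits (suc (r ℕ.+ l)) r (fractionalDigit (scale r l) d)
  fractional-digits r l d binary nonAdjacent = fromDigits (λ k → d -[1+ k ])
    (λ k<r → binary _ (ℤₚ.neg-mono-≤ (+≤+ k<r)) -≤+)
    (λ {k} 1+k<r → trans (ℕₚ.*-comm (d -[1+ k ]) (d -[1+ suc k ]))
                         (nonAdjacent -[1+ suc k ] (ℤₚ.neg-mono-≤ (+≤+ 1+k<r)) -<+))
    (λ {k} _ → ℤₚ.abs-* (+ d -[1+ k ]) (+ fib (suc (r ℕ.+ l) ℕ.∸ k)))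

  conjugate-digits : ∀ r l d → Binary r l d → NonAdjacent r l d
    → FibonacciDigits (suc (r ℕ.+ l)) l (conjugateDigit (scale r l) d)
  conjugate-digits r l d binary nonAdjacent = fromDigits (λ k → d (+ suc k))
    (λ k<l → binary _ ℤₚ.neg-≤-pos (+≤+ k<l))
    (λ {k} 1+k<l → subst (λ j → d (+ suc k) ℕ.* d (+ j) ≡ 0) (ℕₚ.+-comm (suc k) 1)
                         (nonAdjacent _ ℤₚ.neg-≤-pos (+<+ 1+k<l)))
    (λ {k} _ → trans (ℤₚ.abs-* (+ d (+ suc k)) _) (cong (d (+ suc k) ℕ.*_) (∣sgn*∣ (suc k) _)))

  fractionalPart-bounds : ∀ r l d → Binary r l d → NonAdjacent r l d
    → 0≤ fractionalPart (scale r l) r d < fib (scale r l)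
  fractionalPart-bounds r l d binary nonAdjacent =
    nonneg , subst (ℤ._< _) (ℤₚ.0≤i⇒+∣i∣≡i nonneg) (+<+ below)
    where
    nonneg : + 0 ℤ.≤ fractionalPart (scale r l) r d
    nonneg = ∑-nonneg r λ {k} _ → subst (+ 0 ℤ.≤_) (ℤₚ.pos-* (d -[1+ k ]) _) (+≤+ z≤n)
    below : ∣ fractionalPart (scale r l) r d ∣ < fib (scale r l)
    below = zeckendorf (s≤s (ℕₚ.m≤m+n r l)) (fractional-digits r l d binary nonAdjacent)

  conjugatePart-bounds : ∀ r l d → Binary r l d → NonAdjacent r l d
    → ∀ i → 1 ≤ i → i ≤ l → d (+ i) ≡ 1 → (∀ j → 1 ≤ j → j < i → d (+ j) ≡ 0)
    → 0≤ conjugatePart (scale r l) l d + parityε i * + fib (scale r l) < fib (scale r l)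
  conjugatePart-bounds r l d binary nonAdjacent (suc j) _ i≤l dᵢ≡1 leading =
    subst (0≤_< F) regroup
      (window (suc j) (W - h j) (fib-≤-suc Z) (fib-mono (s≤s (s≤s (ℕₚ.m∸n≤m (r ℕ.+ l) j))))
              (leading-digit j i≤l (ℕₚ.m≤n+m l r) (conjugate-digits r l d binary nonAdjacent)
                             zeros nonzero))
    where
    F Z : ℕ
    F = fib (scale r l)
    Z = r ℕ.+ l ℕ.∸ j
    h : ℕ → ℤ
    h = conjugateDigit (scale r l) d
    W : ℤ
    W = conjugatePart (scale r l) l d
    lead : h j ≡ sgn (suc j) * + fib (suc Z)
    lead = trans (cong₂ (λ e n → + e * (sgn (suc j) * + fib n)) dᵢ≡1 (ℕₚ.+-∸-assoc 1 j≤r+l))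
                 (ℤₚ.*-identityˡ (sgn (suc j) * + fib (suc Z)))
      where
      j≤r+l : j ≤ r ℕ.+ l
      j≤r+l = ℕₚ.≤-trans (ℕₚ.n≤1+n j) (ℕₚ.≤-trans i≤l (ℕₚ.m≤n+m l r))
    zeros : ∀ {k} → k < j → h k ≡ + 0
    zeros {k} k<j rewrite leading (suc k) (s≤s z≤n) (s≤s k<j) = refl
    nonzero : h j ≢ + 0
    nonzero hⱼ≡0 = ℕₚ.<⇒≢ (fib-pos {suc Z} (s≤s z≤n))
      (trans (sym (cong ∣_∣ hⱼ≡0)) (trans (cong ∣_∣ lead) (∣sgn*∣ (suc j) (fib (suc Z)))))
    regroup : sgn (suc j) * + fib (suc Z) + parityε (suc j) * + F + (W - h j)
              ≡ W + parityε (suc j) * + F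
    regroup = trans (cong (λ a → a + parityε (suc j) * + F + (W - h j)) (sym lead))
                    (reassoc (h j) (parityε (suc j) * + F) W)
      where
      reassoc : ∀ a e w → a + e + (w - a) ≡ w + e
      reassoc = solve-∀

open import Data.Nat using (ℕ; suc; _≤_; _<_; _*_)
open import Data.Integer as ℤ using (ℤ; +_; _+_; _-_; -_)
open import Relation.Binary.PropositionalEquality using (_≡_)

theorem2 : (N : ℕ) → 1 ≤ N → (r l : ℕ) → (d : ℤ → ℕ)
    → (∀ k → - (+ r) ℤ.≤ k → k ℤ.≤ + l → d k ≤ 1)
    → (∀ k → - (+ r) ℤ.≤ k → k ℤ.< + l → d k * d (k + + 1) ≡ 0)
    → embed (+ N) ≡ phiValue r l d
    → (i : ℕ) → 1 ≤ i → i ≤ l → d (+ i) ≡ 1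
    → (∀ j → 1 ≤ j → j < i → d (+ j) ≡ 0)
    → + N ≡ (lucasPart r d + + d (+ 0)) - parityε i
theorem2 N _ r l d binary nonAdjacent value i 1≤i i≤l dᵢ≡1 leading =
  cancel-scaled (lucasPart r d) (+ d (+ 0)) (parityε i)
    (Λ-expansion N r l d value)
    (fractionalPart-bounds r l d binary nonAdjacent)
    (conjugatePart-bounds r l d binary nonAdjacent i 1≤i i≤l dᵢ≡1 leading)
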